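{- For all formulas $\phi,\psi,\theta$: if $\phi\vdash_{\mathbf{CK}}\psi$ and $\psi\vdash_{\mathbf{CK}}\phi$, then $\Box_\phi\theta\vdash_{\mathbf{CK}}\Box_\psi\theta$.
   Context: Formulas are built from propositional variables and $\bot$ using $\lnot,\supset,\land,\lor$ and a binary operator: if $\phi,\psi$ are formulas, so is $\Box_\phi\psi$. Abbreviations: $\top:=\lnot\bot$, $\Diamond_\phi\psi:=\lnot\Box_\phi\lnot\psi$. Prefixed formulas are expressions $i\triangleright\phi$ and $i\,r_\phi\,j$, where $i,j$ are positive integer indices. The $\mathbf{Ck}$ rules (premises $\Rightarrow$ conclusions; "$|$" separates branches): $i\triangleright\phi\land\psi\Rightarrow i\triangleright\phi,\ i\triangleright\psi$; $i\triangleright\lnot(\phi\land\psi)\Rightarrow i\triangleright\lnot\phi\ |\ i\triangleright\lnot\psi$; $i\triangleright\phi\lor\psi\Rightarrow i\triangleright\phi\ |\ i\triangleright\psi$; $i\triangleright\lnot(\phi\lor\psi)\Rightarrow i\triangleright\lnot\phi,\ i\triangleright\lnot\psi$; $i\triangleright\phi\supset\psi\Rightarrow i\triangleright\lnot\phi\ |\ i\triangleright\psi$; $i\triangleright\lnot(\phi\supset\psi)\Rightarrow i\triangleright\phi,\ i\triangleright\lnot\psi$; $i\triangleright\lnot\lnot\phi\Rightarrow i\triangleright\phi$; ($\Box$) $i\triangleright\Box_\phi\psi$ and $i\,r_\phi\,j\Rightarrow j\triangleright\psi$; ($\lnot\Box$) $i\triangleright\lnot\Box_\phi\psi\Rightarrow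 i\,r_\phi\,j,\ j\triangleright\lnot\psi$ with $j$ new to the branch; ($\Diamond$) $i\triangleright\Diamond_\phi\psi\Rightarrow i\,r_\phi\,j,\ j\triangleright\psi$ with $j$ new; ($\lnot\Diamond$) $i\triangleright\lnot\Diamond_\phi\psi$ and $i\,r_\phi\,j\Rightarrow j\triangleright\lnot\psi$. The $\mathbf{CK}$ system consists of these rules plus: (cut) no premises $\Rightarrow i\triangleright\phi\ |\ i\triangleright\lnot\phi$, for any formula $\phi$, where $i$ already occurs on the branch; (ea) $i\,r_\phi\,j\Rightarrow (k\triangleright\lnot\phi,\ k\triangleright\psi)\ |\ (k\triangleright\phi,\ k\triangleright\lnot\psi)\ |\ i\,r_\psi\,j$, for any formula $\psi$, where $k$ is new to the branch. A tableau from a set of prefixed formulas is a downward-branching tree of prefixed formulas each of which is an assumption or a conclusion of a rule applied to formulas above it on its branch (all conclusions of a branching rule placed as siblings). A branch is closed if it contains $i\triangleright\theta$ and $i\triangleright\lnot\theta$ for some $i,\theta$, or contains $i\triangleright\bot$; a tableau is closed if all its branches are. $\Gamma\vdash_{\mathbf{CK}}\phi$ means there is a closed tableau using only $\mathbf{CK}$ rules with assumptions $\{1\triangleright\psi:\psi\in\Gamma\}\cup\{1\triangleright\lnot\phi\}$. -}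

module Defs where

open import Data.Nat using (ℕ; _≤_)
open import Data.List using (List; _∷_; []; map)
open import Data.List.Membership.Propositional using (_∈_)
open import Data.Product using (_×_)
open import Data.Sum using (_⊎_)
open import Relation.Binary.PropositionalEquality using (_≡_)
open import Relation.Nullary using (¬_)
open import Data.List.Relation.Unary.Any using (Any)

data Formula : Set where
  var  : ℕ → Formula
  ⊥'   : Formula
  ¬'_  : Formula → Formula
  _⊃_  : Formula → Formula → Formula
  _∧'_ : Formula → Formula → Formula
  _∨'_ : Formula → Formula → Formula
  □    : Formula → Formula → Formula   -- □ φ ψ  is  □_φ ψ

⊤' : Formula
⊤' = ¬' ⊥'

◇ : Formula → Formula → Formula
◇ φ ψ = ¬' (□ φ (¬' ψ))

-- Prefixed formulas: i ▷ φ  and  i r[ φ ] j.  Indices are naturals; only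
-- positive ones are ever introduced (assumptions use 1, fresh ones are ≥ 1).
data PF : Set where
  _▷_    : ℕ → Formula → PF
  _r[_]_ : ℕ → Formula → ℕ → PF

Branch : Set
Branch = List PF

data OccursIn (k : ℕ) : PF → Set where
  occ▷  : ∀ {φ} → OccursIn k (k ▷ φ)
  occrˡ : ∀ {φ j} → OccursIn k (k r[ φ ] j)
  occrʳ : ∀ {φ i} → OccursIn k (i r[ φ ] k)

OccursOn : ℕ → Branch → Set
OccursOn k B = Any (OccursIn k) B

Fresh : ℕ → Branch → Set
Fresh k B = (1 ≤ k) × ¬ OccursOn k B

-- A branch B closes iff a closed (sub)tableau can be grown below it using
-- the CK rules.  Each constructor is one rule application: its premises lie on
-- the branch, and every branch obtained by adding the conclusions of one of
-- the alternatives must close.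
data Closes : Branch → Set where
  clash : ∀ {B i θ} → (i ▷ θ) ∈ B → (i ▷ (¬' θ)) ∈ B → Closes B
  bot   : ∀ {B i} → (i ▷ ⊥') ∈ B → Closes B
  r∧   : ∀ {B i φ ψ} → (i ▷ (φ ∧' ψ)) ∈ B →
         Closes ((i ▷ φ) ∷ (i ▷ ψ) ∷ B) → Closes B
  r¬∧  : ∀ {B i φ ψ} → (i ▷ (¬' (φ ∧' ψ))) ∈ B →
         Closes ((i ▷ (¬' φ)) ∷ B) → Closes ((i ▷ (¬' ψ)) ∷ B) → Closes B
  r∨   : ∀ {B i φ ψ} → (i ▷ (φ ∨' ψ)) ∈ B →
         Closes ((i ▷ φ) ∷ B) → Closes ((i ▷ ψ) ∷ B) → Closes B
  r¬∨  : ∀ {B i φ ψ} → (i ▷ (¬' (φ ∨' ψ))) ∈ B →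
         Closes ((i ▷ (¬' φ)) ∷ (i ▷ (¬' ψ)) ∷ B) → Closes B
  r⊃   : ∀ {B i φ ψ} → (i ▷ (φ ⊃ ψ)) ∈ B →
         Closes ((i ▷ (¬' φ)) ∷ B) → Closes ((i ▷ ψ) ∷ B) → Closes B
  r¬⊃  : ∀ {B i φ ψ} → (i ▷ (¬' (φ ⊃ ψ))) ∈ B →
         Closes ((i ▷ φ) ∷ (i ▷ (¬' ψ)) ∷ B) → Closes B
  r¬¬  : ∀ {B i φ} → (i ▷ (¬' (¬' φ))) ∈ B →
         Closes ((i ▷ φ) ∷ B) → Closes B
  r□   : ∀ {B i j φ ψ} → (i ▷ □ φ ψ) ∈ B → (i r[ φ ] j) ∈ B →
         Closes ((j ▷ ψ) ∷ B) → Closes B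
  r¬□  : ∀ {B i φ ψ} j → (i ▷ (¬' (□ φ ψ))) ∈ B → Fresh j B →
         Closes ((i r[ φ ] j) ∷ (j ▷ (¬' ψ)) ∷ B) → Closes B
  r◇   : ∀ {B i φ ψ} j → (i ▷ ◇ φ ψ) ∈ B → Fresh j B →
         Closes ((i r[ φ ] j) ∷ (j ▷ ψ) ∷ B) → Closes B
  r¬◇  : ∀ {B i j φ ψ} → (i ▷ (¬' (◇ φ ψ))) ∈ B → (i r[ φ ] j) ∈ B →
         Closes ((j ▷ (¬' ψ)) ∷ B) → Closes B
  cut  : ∀ {B} i φ → OccursOn i B →
         Closes ((i ▷ φ) ∷ B) → Closes ((i ▷ (¬' φ)) ∷ B) → Closes B
  ea   : ∀ {B i j φ} ψ k → (i r[ φ ] j) ∈ B → Fresh k B →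
         Closes ((k ▷ (¬' φ)) ∷ (k ▷ ψ) ∷ B) →
         Closes ((k ▷ φ) ∷ (k ▷ (¬' ψ)) ∷ B) →
         Closes ((i r[ ψ ] j) ∷ B) → Closes B

_⊢CK_ : List Formula → Formula → Set
Γ ⊢CK φ = Closes ((1 ▷ (¬' φ)) ∷ map (1 ▷_) Γ)

module Submission where

-- Close the tableau for 1 ▷ □_φ θ, 1 ▷ ¬□_ψ θ as follows.
-- The (¬□) rule adds 1 r_ψ 2 and 2 ▷ ¬θ.  The (ea) rule on 1 r_ψ 2 with the
-- formula φ and a fresh index 3 yields three branches:
--   * 3 ▷ ¬ψ, 3 ▷ φ  — closed by the given tableau for φ ⊢ ψ, moved to index 3;
--   * 3 ▷ ψ, 3 ▷ ¬φ  — closed by the given tableau for ψ ⊢ φ, moved to index 3;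
--   * 1 r_φ 2        — the (□) rule gives 2 ▷ θ, which clashes with 2 ▷ ¬θ.
-- The only general fact needed is that closed tableaux may be relabelled:
-- if every prefixed formula of B, with its indices renamed by ρ, lies on B',
-- then B' closes whenever B does.  Freshness side conditions are handled by
-- redirecting the fresh index of each rule to an index above every index on
-- B'.

open import Defs
open import Data.List using (_∷_; []; map)
open import Data.List.Membership.Propositional using (_∈_)
open import Data.List.Membership.Propositional.Properties using (∈-map⁻)
open import Data.List.Relation.Unary.Any using (here; there)
open import Data.Nat using (ℕ; suc; _≤_; _⊔_; s≤s; z≤n)
open import Data.Nat.Properties using (_≟_; ≤-trans; m≤m⊔n; m≤n⊔m; n≮n)
open import Data.Product using (_×_; _,_; ∃)
open import Data.Empty using (⊥-elim)
open import Relation.Binary.PropositionalEquality using (_≡_; refl; sym; cong; cong₂; subst)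
open import Relation.Nullary using (¬_; yes; no)

relabel : (ℕ → ℕ) → PF → PF
relabel ρ (i ▷ φ) = ρ i ▷ φ
relabel ρ (i r[ φ ] j) = ρ i r[ φ ] ρ j

Embeds : (ℕ → ℕ) → Branch → Branch → Set
Embeds ρ B B' = ∀ {x} → x ∈ B → relabel ρ x ∈ B'

embeds-∷ : ∀ {ρ B B'} c → Embeds ρ B B' → Embeds ρ (c ∷ B) (relabel ρ c ∷ B')
embeds-∷ c e (here refl) = here refl
embeds-∷ c e (there p) = there (e p)

embeds-∷∷ : ∀ {ρ B B'} c d → Embeds ρ B B' →
  Embeds ρ (c ∷ d ∷ B) (relabel ρ c ∷ relabel ρ d ∷ B')
embeds-∷∷ c d e = embeds-∷ c (embeds-∷ d e)

occurs-∈ : ∀ {j x B} → x ∈ B → OccursIn j x → OccursOn j B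
occurs-∈ (here refl) o = here o
occurs-∈ (there p) o = there (occurs-∈ p o)

occurs-witness : ∀ {j B} → OccursOn j B → ∃ λ x → (x ∈ B) × OccursIn j x
occurs-witness (here o) = _ , here refl , o
occurs-witness (there p) with occurs-witness p
... | x , m , o = x , there m , o

occurs-relabel : ∀ {i} ρ x → OccursIn i x → OccursIn (ρ i) (relabel ρ x)
occurs-relabel ρ _ occ▷ = occ▷
occurs-relabel ρ _ occrˡ = occrˡ
occurs-relabel ρ _ occrʳ = occrʳ

_[_↦_] : (ℕ → ℕ) → ℕ → ℕ → ℕ → ℕ
(ρ [ j ↦ j' ]) n with n ≟ j
... | yes _ = j'
... | no _ = ρ n

redirect-hit : ∀ ρ j j' → (ρ [ j ↦ j' ]) j ≡ j'
redirect-hit ρ j j' with j ≟ j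
... | yes _ = refl
... | no j≢j = ⊥-elim (j≢j refl)

redirect-miss : ∀ ρ {j} j' n → ¬ n ≡ j → (ρ [ j ↦ j' ]) n ≡ ρ n
redirect-miss ρ {j} j' n n≢j with n ≟ j
... | yes n≡j = ⊥-elim (n≢j n≡j)
... | no _ = refl

relabel-redirect : ∀ ρ {j} j' x → ¬ OccursIn j x → relabel (ρ [ j ↦ j' ]) x ≡ relabel ρ x
relabel-redirect ρ j' (i ▷ φ) ¬o =
  cong (_▷ φ) (redirect-miss ρ j' i λ { refl → ¬o occ▷ })
relabel-redirect ρ j' (i r[ φ ] k) ¬o =
  cong₂ (_r[ φ ]_) (redirect-miss ρ j' i λ { refl → ¬o occrˡ })
                   (redirect-miss ρ j' k λ { refl → ¬o occrʳ })

embeds-redirect : ∀ {ρ B B'} {j} j' → ¬ OccursOn j B → Embeds ρ B B' →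
  Embeds (ρ [ j ↦ j' ]) B B'
embeds-redirect {ρ} {B' = B'} j' new e {x} p =
  subst (_∈ B') (sym (relabel-redirect ρ j' x λ o → new (occurs-∈ p o))) (e p)

maxIndex : Branch → ℕ
maxIndex [] = 0
maxIndex ((i ▷ _) ∷ B) = i ⊔ maxIndex B
maxIndex ((i r[ _ ] j) ∷ B) = (i ⊔ j) ⊔ maxIndex B

occurs≤maxIndex : ∀ {k B} → OccursOn k B → k ≤ maxIndex B
occurs≤maxIndex {B = (i ▷ _) ∷ B} (here occ▷) = m≤m⊔n i (maxIndex B)
occurs≤maxIndex {B = (i r[ _ ] j) ∷ B} (here occrˡ) =
  ≤-trans (m≤m⊔n i j) (m≤m⊔n (i ⊔ j) (maxIndex B))
occurs≤maxIndex {B = (i r[ _ ] j) ∷ B} (here occrʳ) =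
  ≤-trans (m≤n⊔m i j) (m≤m⊔n (i ⊔ j) (maxIndex B))
occurs≤maxIndex {B = (i ▷ _) ∷ B} (there p) =
  ≤-trans (occurs≤maxIndex p) (m≤n⊔m i (maxIndex B))
occurs≤maxIndex {B = (i r[ _ ] j) ∷ B} (there p) =
  ≤-trans (occurs≤maxIndex p) (m≤n⊔m (i ⊔ j) (maxIndex B))

nextIndex : Branch → ℕ
nextIndex B = suc (maxIndex B)

nextIndex-fresh : ∀ B → Fresh (nextIndex B) B
nextIndex-fresh B = s≤s z≤n , λ o → n≮n (maxIndex B) (occurs≤maxIndex o)

redirect-fresh : ∀ ρ j B' → Fresh ((ρ [ j ↦ nextIndex B' ]) j) B'
redirect-fresh ρ j B' =
  subst (λ n → Fresh n B') (sym (redirect-hit ρ j (nextIndex B'))) (nextIndex-fresh B')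

-- Relabelling theorem: closure is preserved along embeddings.  Each rule is
-- replayed on the image; rules introducing a fresh j send it to nextIndex B'.
closes-relabel : ∀ {B} → Closes B → ∀ ρ {B'} → Embeds ρ B B' → Closes B'
closes-relabel (clash p q) ρ e = clash (e p) (e q)
closes-relabel (bot p) ρ e = bot (e p)
closes-relabel (r∧ p D) ρ e = r∧ (e p) (closes-relabel D ρ (embeds-∷∷ _ _ e))
closes-relabel (r¬∧ p D E) ρ e =
  r¬∧ (e p) (closes-relabel D ρ (embeds-∷ _ e)) (closes-relabel E ρ (embeds-∷ _ e))
closes-relabel (r∨ p D E) ρ e =
  r∨ (e p) (closes-relabel D ρ (embeds-∷ _ e)) (closes-relabel E ρ (embeds-∷ _ e))
closes-relabel (r¬∨ p D) ρ e = r¬∨ (e p) (closes-relabel D ρ (embeds-∷∷ _ _ e))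
closes-relabel (r⊃ p D E) ρ e =
  r⊃ (e p) (closes-relabel D ρ (embeds-∷ _ e)) (closes-relabel E ρ (embeds-∷ _ e))
closes-relabel (r¬⊃ p D) ρ e = r¬⊃ (e p) (closes-relabel D ρ (embeds-∷∷ _ _ e))
closes-relabel (r¬¬ p D) ρ e = r¬¬ (e p) (closes-relabel D ρ (embeds-∷ _ e))
closes-relabel (r□ p q D) ρ e = r□ (e p) (e q) (closes-relabel D ρ (embeds-∷ _ e))
closes-relabel (r¬□ j p (_ , new) D) ρ {B'} e =
  r¬□ _ (e' p) (redirect-fresh ρ j B') (closes-relabel D ρ' (embeds-∷∷ _ _ e'))
  where
    ρ' = ρ [ j ↦ nextIndex B' ]
    e' = embeds-redirect (nextIndex B') new e
closes-relabel (r◇ j p (_ , new) D) ρ {B'} e =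
  r◇ _ (e' p) (redirect-fresh ρ j B') (closes-relabel D ρ' (embeds-∷∷ _ _ e'))
  where
    ρ' = ρ [ j ↦ nextIndex B' ]
    e' = embeds-redirect (nextIndex B') new e
closes-relabel (r¬◇ p q D) ρ e = r¬◇ (e p) (e q) (closes-relabel D ρ (embeds-∷ _ e))
closes-relabel (cut i φ o D E) ρ e with occurs-witness o
... | x , m , oc =
  cut (ρ i) φ (occurs-∈ (e m) (occurs-relabel ρ x oc))
      (closes-relabel D ρ (embeds-∷ _ e)) (closes-relabel E ρ (embeds-∷ _ e))
closes-relabel (ea ψ k p (_ , new) D E F) ρ {B'} e =
  ea ψ _ (e' p) (redirect-fresh ρ k B')
     (closes-relabel D ρ' (embeds-∷∷ _ _ e'))
     (closes-relabel E ρ' (embeds-∷∷ _ _ e'))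
     (closes-relabel F ρ' (embeds-∷ _ e'))
  where
    ρ' = ρ [ k ↦ nextIndex B' ]
    e' = embeds-redirect (nextIndex B') new e

-- A derivation Γ ⊢CK ψ closes any branch carrying Γ and ¬ψ at a common index k:
-- relabel every index of its tableau to k.
replay-at : ∀ {Γ ψ B} k → Γ ⊢CK ψ → (k ▷ (¬' ψ)) ∈ B →
  (∀ {γ} → γ ∈ Γ → (k ▷ γ) ∈ B) → Closes B
replay-at {Γ} {B = B} k D negGoal premises = closes-relabel D (λ _ → k) embed
  where
    embed : Embeds (λ _ → k) ((1 ▷ _) ∷ map (1 ▷_) Γ) B
    embed (here refl) = negGoal
    embed (there p) with ∈-map⁻ (1 ▷_) p
    ... | γ , γ∈Γ , refl = premises γ∈Γ

proposition3 : (φ ψ θ : Formula) → (φ ∷ []) ⊢CK ψ → (ψ ∷ []) ⊢CK φ →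
    (□ φ θ ∷ []) ⊢CK □ ψ θ
proposition3 φ ψ θ φ⊢ψ ψ⊢φ =
  r¬□ _ (here refl) (nextIndex-fresh _)
    (ea φ _ (here refl) (nextIndex-fresh _)
      (replay-at 3 φ⊢ψ (here refl) λ { (here refl) → there (here refl) })
      (replay-at 3 ψ⊢φ (there (here refl)) λ { (here refl) → here refl })
      (r□ (there (there (there (there (here refl))))) (here refl)
        (clash (here refl) (there (there (there (here refl)))))))
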